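{- Let $M=\langle S,(\sim_i)_{i\in\mathcal{A}}\rangle$ be a Beth-Kripke model, $s\in S$, $i\in\mathcal{A}$, and $\varphi\in L(\mathcal{A},\mathbf{AT})$. Then $(M,s)\models K_i\varphi\vee\neg K_i\varphi$.
   Context: $\mathbf{AT}$ is a nonempty set of propositional atoms and $\mathcal{A}$ a set of agents. A Beth model is a triple $\Theta=\langle Q,\leq,F\rangle$ where $(Q,\leq)$ is a partial order with a least element (the root) and $F:Q\to 2^{\mathbf{AT}}$ satisfies $F(\alpha)\subseteq F(\beta)$ whenever $\alpha\leq\beta$; we write $\alpha\in\Theta$ for $\alpha\in Q$. A path through $\alpha$ is a maximal linearly ordered subset containing $\alpha$; a bar for $\alpha$ is a subset meeting every path through $\alpha$. The language $L(\mathcal{A},\mathbf{AT})$ is the smallest set containing $\mathbf{AT}$ and closed under $\neg,\wedge,\vee,\rightarrow$ and $K_i$ ($i\in\mathcal{A}$). A Beth-Kripke model is $M=\langle S,(\sim_i)_{i\in\mathcal{A}}\rangle$ where $S$ is a nonempty set of Beth models over $\mathbf{AT}$ (each $s\in S$ is a Beth model $\Theta_s$ with root $\alpha_s$) and each $\sim_i$ is a binary relation on $S$. For $\Theta\in S$ and $\alpha\in\Theta$: $\alpha\Vdash_M p$ ($p\in\mathbf{AT}$) iff there is a bar $B$ for $\alpha$ with $p\in F(\beta)$ for all $\beta\in B$; $\alpha\Vdash_M\varphi\wedge\psi$ iff both conjuncts hold at $\alpha$; $\alpha\Vdash_M\varphi\vee\psi$ iff there is a bar $B$ for $\alpha$ each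 of whose elements forces $\varphi$ or forces $\psi$; $\alpha\Vdash_M\varphi\rightarrow\psi$ iff every $\beta\geq\alpha$ in $\Theta$ forcing $\varphi$ forces $\psi$; $\alpha\Vdash_M\neg\varphi$ iff no $\beta\geq\alpha$ in $\Theta$ forces $\varphi$; $\alpha\Vdash_M K_i\varphi$ iff for every $\Omega\in S$ with $\Theta\sim_i\Omega$ and every $\beta\in\Omega$, $\beta\Vdash_M\varphi$. Finally $(M,s)\models\varphi$ means $\alpha_s\Vdash_M\varphi$. -}

module Defs where

open import Level using (0ℓ)
open import Data.Product using (Σ; _×_; _,_; ∃; ∃-syntax)
open import Data.Sum using (_⊎_)
open import Relation.Nullary using (¬_)
open import Relation.Unary using (Pred; _⊆_; _∈_)
open import Relation.Binary.PropositionalEquality using (_≡_)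
open import Relation.Binary.Structures using (IsPartialOrder)

data Formula (Ag AT : Set) : Set where
  atom : AT → Formula Ag AT
  ¬ᶠ_  : Formula Ag AT → Formula Ag AT
  _∧ᶠ_ : Formula Ag AT → Formula Ag AT → Formula Ag AT
  _∨ᶠ_ : Formula Ag AT → Formula Ag AT → Formula Ag AT
  _⇒ᶠ_ : Formula Ag AT → Formula Ag AT → Formula Ag AT
  K    : Ag → Formula Ag AT → Formula Ag AT

record BethModel (AT : Set) : Set₁ where
  field
    Q          : Set
    _≤_        : Q → Q → Set
    isPO       : IsPartialOrder _≡_ _≤_
    root       : Q
    root-least : ∀ α → root ≤ α
    F          : Q → Pred AT 0ℓ
    F-mono     : ∀ {α β} → α ≤ β → F α ⊆ F β

  Chain : Pred Q 0ℓ → Set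
  Chain C = ∀ x y → x ∈ C → y ∈ C → (x ≤ y) ⊎ (y ≤ x)

  IsPath : Q → Pred Q 0ℓ → Set₁
  IsPath α P = Chain P × α ∈ P × (∀ D → Chain D → P ⊆ D → D ⊆ P)

  IsBar : Q → Pred Q 0ℓ → Set₁
  IsBar α B = ∀ P → IsPath α P → ∃[ β ] (β ∈ P × β ∈ B)

open BethModel public

record BethKripke (Ag AT : Set) : Set₁ where
  field
    S        : Set
    nonempty : S
    Θ        : S → BethModel AT
    _∼[_]_   : S → Ag → S → Set

open BethKripke public

module Forcing {Ag AT : Set} (M : BethKripke Ag AT) where
  forces : (s : S M) → Q (Θ M s) → Formula Ag AT → Set₁
  forces s α (atom p) =
    ∃[ B ] (IsBar (Θ M s) α B × (∀ β → β ∈ B → p ∈ F (Θ M s) β))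
  forces s α (φ ∧ᶠ ψ) = forces s α φ × forces s α ψ
  forces s α (φ ∨ᶠ ψ) =
    ∃[ B ] (IsBar (Θ M s) α B × (∀ β → β ∈ B → forces s β φ ⊎ forces s β ψ))
  forces s α (φ ⇒ᶠ ψ) =
    ∀ β → _≤_ (Θ M s) α β → forces s β φ → forces s β ψ
  forces s α (¬ᶠ φ) = ∀ β → _≤_ (Θ M s) α β → ¬ forces s β φ
  forces s α (K i φ) =
    ∀ t → _∼[_]_ M s i t → ∀ (β : Q (Θ M t)) → forces t β φ

_,_⊨_ : {Ag AT : Set} (M : BethKripke Ag AT) → S M → Formula Ag AT → Set₁
M , s ⊨ φ = Forcing.forces M s (root (Θ M s)) φ

-- Forcing Kᵢ φ at a node of Θ_s only quantifies over the models ∼ᵢ-related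
-- to s, so it does not depend on the node. Classically it therefore either
-- holds at the root, or fails at every node and ¬ Kᵢ φ holds at the root;
-- the singleton of the root is a bar witnessing the disjunction.
module Submission where

open import Defs
open import Level using (zero; suc)
open import Axiom.ExcludedMiddle using (ExcludedMiddle)
open import Data.Product using (_,_)
open import Data.Sum using (_⊎_; inj₁; inj₂)
open import Relation.Nullary using (yes; no)
open import Relation.Unary using (｛_｝)
open import Relation.Binary.PropositionalEquality using (_≡_; refl)

singleton-isBar : ∀ {AT} (Θ : BethModel AT) (α : Q Θ) → IsBar Θ α ｛ α ｝
singleton-isBar Θ α P (_ , α∈P , _) = α , α∈P , refl

module _ {Ag AT : Set} (M : BethKripke Ag AT) where
  open Forcing M

  forces-∨-intro : ∀ {s α φ ψ} → forces s α φ ⊎ forces s α ψ → forces s α (φ ∨ᶠ ψ)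
  forces-∨-intro {s} {α} φ⊎ψ = ｛ α ｝ , singleton-isBar (Θ M s) α , λ { _ refl → φ⊎ψ }

  forces-K-node-independent : ∀ {s i φ} {α β : Q (Θ M s)} →
    forces s α (K i φ) → forces s β (K i φ)
  forces-K-node-independent Kφ = Kφ

  forces-K-or-¬K : ExcludedMiddle (suc zero) →
    ∀ s α i φ → forces s α (K i φ) ⊎ forces s α (¬ᶠ K i φ)
  forces-K-or-¬K lem s α i φ with lem {forces s α (K i φ)}
  ... | yes Kφ = inj₁ Kφ
  ... | no ¬Kφ = inj₂ λ β _ Kφ → ¬Kφ (forces-K-node-independent {s} {i} {φ} {β} {α} Kφ)

mainTheorem3 : ExcludedMiddle (suc zero) →
    {Ag AT : Set} → AT →
    (M : BethKripke Ag AT) (s : S M) (i : Ag) (φ : Formula Ag AT) →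
    M , s ⊨ (K i φ ∨ᶠ (¬ᶠ K i φ))
mainTheorem3 lem _ M s i φ =
  forces-∨-intro M {φ = K i φ} {ψ = ¬ᶠ K i φ}
    (forces-K-or-¬K M lem s (root (Θ M s)) i φ)
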